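{- For every positive integer $n$, $va^\equiv_1(K_{2,n})=\lceil (n+3)/3\rceil$.
   Context: All graphs are finite and simple. For a graph $G$ with $N=|V(G)|$ vertices, an equitable $(q,r)$-tree-coloring of $G$ is a partition of $V(G)$ into $q$ sets, each of size $\lfloor N/q\rfloor$ or $\lceil N/q\rceil$, such that each set induces a forest of maximum degree at most $r$. The strong equitable vertex $r$-arboricity $va^\equiv_r(G)$ is the minimum $p$ such that $G$ has an equitable $(q,r)$-tree-coloring for every integer $q\ge p$. $K_{m,n}$ is the complete bipartite graph with parts of sizes $m$ and $n$. -}

module Defs where

open import Data.Nat using (ℕ; zero; suc; _+_; _∸_; _≤_; _<_)
open import Data.Nat.DivMod using (_/_)
open import Data.Fin using (Fin; toℕ; _≟_)
open import Data.Fin using () renaming (_≟_ to _≟ᶠ_)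
open import Data.Bool using (Bool; true; false; T; _∧_)
open import Data.List using (List; []; _∷_; _++_; [_]; length; filterᵇ; allFin)
open import Data.List.Relation.Unary.All using (All)
open import Data.List.Relation.Unary.Unique.Propositional using (Unique)
open import Data.List.Relation.Unary.Linked using (Linked)
open import Data.Nat using (_<ᵇ_)
open import Data.Product using (Σ; _×_; ∃)
open import Data.Sum using (_⊎_)
open import Data.Unit using (⊤)
open import Data.Empty using (⊥)
open import Relation.Binary.PropositionalEquality using (_≡_)
open import Relation.Nullary using (¬_; does)

record Graph : Set where
  field
    N       : ℕ
    adj     : Fin N → Fin N → Bool
    adj-sym : ∀ u v → adj u v ≡ adj v u
    adj-irr : ∀ v → adj v v ≡ false
open Graph public

⌈_/suc_⌉ : ℕ → ℕ → ℕ
⌈ a /suc b ⌉ = (a + b) / suc b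

inFirst : (m : ℕ) {k : ℕ} → Fin k → Bool
inFirst m v = toℕ v <ᵇ m

xor : Bool → Bool → Bool
xor true  b = Data.Bool.not b
xor false b = b

K : ℕ → ℕ → Graph
K m n = record
  { N = m + n
  ; adj = λ u v → xor (inFirst m u) (inFirst m v)
  ; adj-sym = λ u v → xsym (inFirst m u) (inFirst m v)
  ; adj-irr = λ v → xirr (inFirst m v)
  }
  where
  open import Relation.Binary.PropositionalEquality using (refl)
  xsym : ∀ a b → xor a b ≡ xor b a
  xsym true true = refl
  xsym true false = refl
  xsym false true = refl
  xsym false false = refl
  xirr : ∀ a → xor a a ≡ false
  xirr true = refl
  xirr false = refl

module _ (G : Graph) where

  Adj : Fin (N G) → Fin (N G) → Set
  Adj u v = T (adj G u v)

  record CycleIn (S : Fin (N G) → Set) : Set where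
    field
      verts   : List (Fin (N G))
      len     : 3 ≤ length verts
      inS     : All S verts
      distinct : Unique verts
      closed  : Σ (Fin (N G)) λ x → Σ (List (Fin (N G))) λ xs →
                  (verts ≡ x ∷ xs) × Linked Adj (x ∷ xs ++ [ x ])

  module _ {q : ℕ} (c : Fin (N G) → Fin q) where

    classSize : Fin q → ℕ
    classSize k = length (filterᵇ (λ v → does (c v ≟ᶠ k)) (allFin (N G)))

    classDeg : Fin (N G) → ℕ
    classDeg v = length (filterᵇ (λ u → adj G v u ∧ does (c u ≟ᶠ c v)) (allFin (N G)))

    InducesForest≤ : ℕ → Fin q → Set
    InducesForest≤ r k =
      ¬ CycleIn (λ v → c v ≡ k) × (∀ v → c v ≡ k → classDeg v ≤ r)

-- class size is ⌊N/q⌋ or ⌈N/q⌉ (vacuous for q = 0, there are no classes)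
SizeOK : (q N s : ℕ) → Set
SizeOK zero N s = ⊤
SizeOK (suc q) N s = (s ≡ N / suc q) ⊎ (s ≡ ⌈ N /suc q ⌉)

EqTreeColorable : Graph → ℕ → ℕ → Set
EqTreeColorable G q r =
  Σ (Fin (N G) → Fin q) λ c →
    ∀ k → SizeOK q (N G) (classSize G c k) × InducesForest≤ G c r k

AllFrom : Graph → ℕ → ℕ → Set
AllFrom G r p = ∀ q → p ≤ q → EqTreeColorable G q r

IsStrongEqVA : Graph → ℕ → ℕ → Set
IsStrongEqVA G r p = AllFrom G r p × (∀ p′ → AllFrom G r p′ → p ≤ p′)

-- Lower bound: if 3q ≤ n + 2, every class of an equitable q-colouring of K_{2,n} has at least
-- three vertices.  A class inducing a graph of maximum degree ≤ 1 contains at most one right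
-- vertex together with a left vertex, so the class of the first left vertex must also contain
-- the second one and a right vertex y; but y then has two neighbours in its class.
--
-- Upper bound: for q = m + 1 with n + 3 ≤ 3q we have n ≤ 3m.  Colour right vertex j by j mod m
-- and both left vertices by the extra colour m, except when n < m, where the second left vertex
-- gets the colour m − 1 that no right vertex uses.  Every class is then independent, and
-- counting residues modulo m shows that all class sizes are ⌊(n+2)/q⌋ or ⌈(n+2)/q⌉.
module Submission where

open import Data.Bool using (Bool; true; false; _∧_)
open import Data.Bool.Properties using (T-≡)
open import Data.Fin as Fin using (Fin; zero; suc; toℕ; _↑ˡ_; _↑ʳ_)
open import Data.Fin.Properties
  using (toℕ<n; toℕ-injective; toℕ-↑ˡ; toℕ-↑ʳ; toℕ-inject₁; toℕ-fromℕ<; toℕ-fromℕ; fromℕ≢inject₁)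
open import Data.List using ([]; _∷_; length; filterᵇ; tabulate)
open import Data.List.Relation.Unary.All using (_∷_)
open import Data.List.Relation.Unary.AllPairs using (_∷_)
open import Data.List.Relation.Unary.Linked using (_∷_)
open import Data.Nat as ℕ using (ℕ; zero; suc; _+_; _*_; _∸_; _≤_; _<_; z≤n; s≤s; _<?_; _≤?_)
open import Data.Nat.Properties
open import Data.Nat.DivMod
  using (_/_; _%_; _mod_; m≡m%n+[m/n]*n; m%n<n; m<n⇒m%n≡m; %-remove-+ˡ; m<n*o⇒m/o<n; m*n/n≡m; /-monoˡ-≤)
open import Data.Nat.Divisibility using (_∣_; ∣-refl; n∣m*n)
open import Data.Nat.Tactic.RingSolver using (solve-∀)
open import Data.Product using (∃; _×_; _,_; proj₁; proj₂)
open import Data.Sum using (inj₁; inj₂)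
open import Function using (_∘_)
open import Function.Bundles using (Equivalence; _⇔_; mk⇔)
open import Relation.Binary.PropositionalEquality
open import Relation.Nullary using (¬_; Dec; does; yes; no; contradiction)
open import Relation.Nullary.Decidable using (dec-true; dec-false)

open import Defs

𝟙 : Bool → ℕ
𝟙 true  = 1
𝟙 false = 0

does≡true⇒ : ∀ {A : Set} (a? : Dec A) → does a? ≡ true → A
does≡true⇒ (yes a) _ = a

𝟙≥1⇒true : ∀ {b} → 1 ≤ 𝟙 b → b ≡ true
𝟙≥1⇒true {true} _ = refl

𝟙≤1 : ∀ b → 𝟙 b ≤ 1
𝟙≤1 true  = ≤-refl
𝟙≤1 false = z≤n

does-≟-toℕ : ∀ {x} (i j : Fin x) → does (i Fin.≟ j) ≡ does (toℕ i ℕ.≟ toℕ j)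
does-≟-toℕ i j with i Fin.≟ j
... | yes refl = sym (dec-true (toℕ i ℕ.≟ toℕ i) refl)
... | no  i≢j  = sym (dec-false (toℕ i ℕ.≟ toℕ j) (i≢j ∘ toℕ-injective))

count : ∀ {n} → (Fin n → Bool) → ℕ
count {zero}  P = 0
count {suc n} P = 𝟙 (P zero) + count (P ∘ suc)

length-filterᵇ-tabulate : ∀ {A : Set} {n} (p : A → Bool) (f : Fin n → A) →
                          length (filterᵇ p (tabulate f)) ≡ count (p ∘ f)
length-filterᵇ-tabulate {n = zero}  p f = refl
length-filterᵇ-tabulate {n = suc n} p f with p (f zero)
... | true  = cong suc (length-filterᵇ-tabulate p (f ∘ suc))
... | false = length-filterᵇ-tabulate p (f ∘ suc)

count-cong : ∀ {n} {P Q : Fin n → Bool} → (∀ i → P i ≡ Q i) → count P ≡ count Q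
count-cong {zero}  eq = refl
count-cong {suc n} eq = cong₂ _+_ (cong 𝟙 (eq zero)) (count-cong (eq ∘ suc))

count-none : ∀ {n} {P : Fin n → Bool} → (∀ i → P i ≡ false) → count P ≡ 0
count-none {zero}  none = refl
count-none {suc n} none rewrite none zero = count-none (none ∘ suc)

count>0⇒∃ : ∀ {n} (P : Fin n → Bool) → 0 < count P → ∃ λ i → P i ≡ true
count>0⇒∃ {suc n} P pos with P zero in eq
... | true  = zero , eq
... | false with count>0⇒∃ (P ∘ suc) pos
...   | i , Pi = suc i , Pi

count-≥1 : ∀ {n} (P : Fin n → Bool) {i} → P i ≡ true → 1 ≤ count P
count-≥1 P {zero}  Pi rewrite Pi = s≤s z≤n
count-≥1 P {suc i} Pi = ≤-trans (count-≥1 (P ∘ suc) Pi) (m≤n+m _ (𝟙 (P zero)))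

count-≥2 : ∀ {n} (P : Fin n → Bool) {i j} → i ≢ j → P i ≡ true → P j ≡ true → 2 ≤ count P
count-≥2 P {zero}  {zero}  i≢j _  _  = contradiction refl i≢j
count-≥2 P {zero}  {suc j} _   Pi Pj rewrite Pi = s≤s (count-≥1 (P ∘ suc) Pj)
count-≥2 P {suc i} {zero}  _   Pi Pj rewrite Pj = s≤s (count-≥1 (P ∘ suc) Pi)
count-≥2 P {suc i} {suc j} i≢j Pi Pj =
  ≤-trans (count-≥2 (P ∘ suc) (i≢j ∘ cong suc) Pi Pj) (m≤n+m _ (𝟙 (P zero)))

count-++ : ∀ {m n} (P : Fin (m + n) → Bool) →
           count P ≡ count (P ∘ (_↑ˡ n)) + count (P ∘ (m ↑ʳ_))
count-++ {zero}  P = refl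
count-++ {suc m} {n} P = trans (cong (𝟙 (P zero) +_) (count-++ {m} {n} (P ∘ suc)))
                           (sym (+-assoc (𝟙 (P zero)) _ _))

index≟ : ∀ {x} → ℕ → Fin x → Bool
index≟ κ i = does (toℕ i ℕ.≟ κ)

count-index≟-< : ∀ {x κ} → κ < x → count {x} (index≟ κ) ≡ 1
count-index≟-< {suc x} {zero}  _ = cong suc (count-none {x} λ _ → refl)
count-index≟-< {suc x} {suc κ} (s≤s κ<x) = count-index≟-< κ<x

count-index≟-≥ : ∀ {x κ} → x ≤ κ → count {x} (index≟ κ) ≡ 0
count-index≟-≥ x≤κ = count-none λ i → dec-false (_ ℕ.≟ _) (<⇒≢ (<-≤-trans (toℕ<n i) x≤κ))

residue≟ : ∀ m .{{_ : ℕ.NonZero m}} {x} → ℕ → Fin x → Bool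
residue≟ m κ i = does (toℕ i % m ℕ.≟ κ)

module _ (m : ℕ) .{{_ : ℕ.NonZero m}} (κ : ℕ) where

  count-residue-below : ∀ {x} → x ≤ m → count {x} (residue≟ m κ) ≡ count {x} (index≟ κ)
  count-residue-below {x} x≤m =
    count-cong {x} λ i → cong (λ z → does (z ℕ.≟ κ)) (m<n⇒m%n≡m (<-≤-trans (toℕ<n i) x≤m))

  count-residue-++ : ∀ {y x} → m ∣ y →
                     count {y + x} (residue≟ m κ) ≡ count {y} (residue≟ m κ) + count {x} (residue≟ m κ)
  count-residue-++ {y} {x} m∣y = trans (count-++ {y} {x} _) (cong₂ _+_
    (count-cong {y} λ i → cong (λ z → does (z % m ℕ.≟ κ)) (toℕ-↑ˡ i x))
    (count-cong {x} λ j → cong (λ z → does (z ℕ.≟ κ))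
      (trans (cong (_% m) (toℕ-↑ʳ y j)) (%-remove-+ˡ (toℕ j) m∣y))))

  count-residue-multiple : ∀ t → count {t * m} (residue≟ m κ) ≡ t * count {m} (index≟ κ)
  count-residue-multiple zero    = refl
  count-residue-multiple (suc t) = begin
    count {m + t * m} (residue≟ m κ)
      ≡⟨ count-residue-++ {m} {t * m} ∣-refl ⟩
    count {m} (residue≟ m κ) + count {t * m} (residue≟ m κ)
      ≡⟨ cong₂ _+_ (count-residue-below {m} ≤-refl) (count-residue-multiple t) ⟩
    count {m} (index≟ κ) + t * count {m} (index≟ κ)
      ∎
    where open ≡-Reasoning

  count-residue : ∀ t {r} → r ≤ m →
                  count {t * m + r} (residue≟ m κ) ≡ t * count {m} (index≟ κ) + count {r} (index≟ κ)
  count-residue t {r} r≤m = trans (count-residue-++ {t * m} {r} (n∣m*n t))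
    (cong₂ _+_ (count-residue-multiple t) (count-residue-below {r} r≤m))

classDeg≡count : ∀ G {q} (c : Fin (N G) → Fin q) v →
                 classDeg G c v ≡ count (λ u → adj G v u ∧ does (c u Fin.≟ c v))
classDeg≡count G c v = length-filterᵇ-tabulate (λ u → adj G v u ∧ does (c u Fin.≟ c v)) (λ u → u)

classSize≡count : ∀ G {q} (c : Fin (N G) → Fin q) k →
                  classSize G c k ≡ count (λ v → does (c v Fin.≟ k))
classSize≡count G c k = length-filterᵇ-tabulate (λ v → does (c v Fin.≟ k)) (λ v → v)

-- In a cycle x, v₁, v₂, … the vertex v₁ has the two distinct neighbours x and v₂.
classDeg≤1⇒acyclic : ∀ G {q} (c : Fin (N G) → Fin q) k →
                     (∀ v → c v ≡ k → classDeg G c v ≤ 1) → ¬ CycleIn G (λ v → c v ≡ k)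
classDeg≤1⇒acyclic G c k deg≤1 record { len = s≤s () ; closed = _ , [] , refl , _ }
classDeg≤1⇒acyclic G c k deg≤1 record { len = s≤s (s≤s ()) ; closed = _ , _ ∷ [] , refl , _ }
classDeg≤1⇒acyclic G c k deg≤1 record { inS = cx ∷ cv₁ ∷ cv₂ ∷ _ ; distinct = (_ ∷ x≢v₂ ∷ _) ∷ _
                                      ; closed = x , v₁ ∷ v₂ ∷ _ , refl , x~v₁ ∷ v₁~v₂ ∷ _ } =
  <⇒≱ (subst (2 ≤_) (sym (classDeg≡count G c v₁)) two-neighbours) (deg≤1 v₁ cv₁)
  where
  two-neighbours : 2 ≤ count (λ u → adj G v₁ u ∧ does (c u Fin.≟ c v₁))
  two-neighbours = count-≥2 _ x≢v₂
    (cong₂ _∧_ (trans (adj-sym G v₁ x) (Equivalence.to T-≡ x~v₁))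
               (dec-true (c x Fin.≟ c v₁) (trans cx (sym cv₁))))
    (cong₂ _∧_ (Equivalence.to T-≡ v₁~v₂)
               (dec-true (c v₂ Fin.≟ c v₁) (trans cv₂ (sym cv₁))))

tree-colouring : ∀ G {q} (c : Fin (N G) → Fin q) →
                 (∀ k → SizeOK q (N G) (classSize G c k)) → (∀ v → classDeg G c v ≤ 1) →
                 EqTreeColorable G q 1
tree-colouring G c sizes deg≤1 =
  c , λ k → sizes k , classDeg≤1⇒acyclic G c k (λ v _ → deg≤1 v) , λ v _ → deg≤1 v

/-unique : ∀ {q₀ s x} → s * suc q₀ ≤ x → x < suc s * suc q₀ → x / suc q₀ ≡ s
/-unique {q₀} {s} {x} lower upper = ≤-antisym (≤-pred (m<n*o⇒m/o<n upper))
  (subst (_≤ x / suc q₀) (m*n/n≡m s (suc q₀)) (/-monoˡ-≤ (suc q₀) lower))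

sizeOK-floor : ∀ {q₀} s {d} → d < suc q₀ → SizeOK (suc q₀) (s * suc q₀ + d) s
sizeOK-floor {q₀} s {d} d<q = inj₁ (sym (/-unique (m≤m+n _ d) upper))
  where
  open ≤-Reasoning
  upper : s * suc q₀ + d < suc s * suc q₀
  upper = begin-strict
    s * suc q₀ + d       <⟨ +-monoʳ-< (s * suc q₀) d<q ⟩
    s * suc q₀ + suc q₀  ≡⟨ +-comm _ (suc q₀) ⟩
    suc s * suc q₀       ∎

sizeOK-ceil : ∀ {q₀} s {d} → 0 < d → d ≤ suc q₀ → SizeOK (suc q₀) (s * suc q₀ + d) (suc s)
sizeOK-ceil {q₀} s {suc d} _ (s≤s d≤q₀) = inj₂ (sym (/-unique lower upper))
  where
  open ≤-Reasoning
  sq : ℕ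
  sq = s * suc q₀
  rearrange : ∀ a b c → suc a + b + c ≡ b + suc c + a
  rearrange = solve-∀
  double : ∀ a b → suc (b + suc a + a) ≡ suc a + (suc a + b)
  double = solve-∀
  lower : suc s * suc q₀ ≤ sq + suc d + q₀
  lower = begin
    suc q₀ + sq          ≤⟨ m≤m+n _ d ⟩
    suc q₀ + sq + d      ≡⟨ rearrange q₀ sq d ⟩
    sq + suc d + q₀      ∎
  upper : sq + suc d + q₀ < suc (suc s) * suc q₀
  upper = begin-strict
    sq + suc d + q₀      ≤⟨ +-monoˡ-≤ q₀ (+-monoʳ-≤ sq (s≤s d≤q₀)) ⟩
    sq + suc q₀ + q₀     <⟨ n<1+n _ ⟩
    suc (sq + suc q₀ + q₀) ≡⟨ double q₀ sq ⟩
    suc q₀ + (suc q₀ + sq) ∎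

sizeOK⇒floor≤ : ∀ {q₀ N s} → SizeOK (suc q₀) N s → N / suc q₀ ≤ s
sizeOK⇒floor≤ (inj₁ refl) = ≤-refl
sizeOK⇒floor≤ {q₀} {N} (inj₂ refl) = /-monoˡ-≤ (suc q₀) (m≤m+n N q₀)

pattern left₀   = zero
pattern left₁   = suc zero
pattern right j = suc (suc j)

module K₂ {n q : ℕ} (c : Fin (2 + n) → Fin q) where

  rightCount : Fin q → ℕ
  rightCount k = count (λ j → does (c (right j) Fin.≟ k))

  classSize-K₂ : ∀ k → classSize (K 2 n) c k ≡
                 𝟙 (does (c left₀ Fin.≟ k)) + (𝟙 (does (c left₁ Fin.≟ k)) + rightCount k)
  classSize-K₂ k = classSize≡count (K 2 n) c k

  classDeg-left₀ : classDeg (K 2 n) c left₀ ≡ rightCount (c left₀)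
  classDeg-left₀ = classDeg≡count (K 2 n) c left₀

  classDeg-left₁ : classDeg (K 2 n) c left₁ ≡ rightCount (c left₁)
  classDeg-left₁ = classDeg≡count (K 2 n) c left₁

  classDeg-right : ∀ j → classDeg (K 2 n) c (right j) ≡
                   𝟙 (does (c left₀ Fin.≟ c (right j))) + 𝟙 (does (c left₁ Fin.≟ c (right j)))
  classDeg-right j = trans (classDeg≡count (K 2 n) c (right j))
    (cong (𝟙 (does (c left₀ Fin.≟ c (right j))) +_)
      (trans (cong (𝟙 (does (c left₁ Fin.≟ c (right j))) +_) (count-none {n} λ _ → refl)) (+-identityʳ _)))

  classDeg≡0 : (∀ j → c (right j) ≢ c left₀) → (∀ j → c (right j) ≢ c left₁) →
               ∀ v → classDeg (K 2 n) c v ≡ 0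
  classDeg≡0 ≢left₀ ≢left₁ left₀ = trans classDeg-left₀
    (count-none λ j → dec-false (c (right j) Fin.≟ c left₀) (≢left₀ j))
  classDeg≡0 ≢left₀ ≢left₁ left₁ = trans classDeg-left₁
    (count-none λ j → dec-false (c (right j) Fin.≟ c left₁) (≢left₁ j))
  classDeg≡0 ≢left₀ ≢left₁ (right j) = trans (classDeg-right j) (cong₂ _+_
    (cong 𝟙 (dec-false (c left₀ Fin.≟ c (right j)) (≢left₀ j ∘ sym)))
    (cong 𝟙 (dec-false (c left₁ Fin.≟ c (right j)) (≢left₁ j ∘ sym))))

no-equitable-tree-colouring : ∀ {n q} → q * 3 ≤ 2 + n → ¬ EqTreeColorable (K 2 n) q 1
no-equitable-tree-colouring {q = zero} _ (c , _) with c left₀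
... | ()
no-equitable-tree-colouring {n} {suc q₀} q*3≤N (c , equitable) =
  <⇒≱ (subst (2 ≤_) (sym (classDeg-right j)) two) (deg≤1 (right j) right-j∈k)
  where
  open K₂ c
  k : Fin (suc q₀)
  k = c left₀
  deg≤1 : ∀ v → c v ≡ k → classDeg (K 2 n) c v ≤ 1
  deg≤1 = proj₂ (proj₂ (equitable k))
  rightCount≤1 : rightCount k ≤ 1
  rightCount≤1 = subst (_≤ 1) classDeg-left₀ (deg≤1 left₀ refl)
  left₁? : Dec (c left₁ ≡ k)
  left₁? = c left₁ Fin.≟ k
  classSize-k : classSize (K 2 n) c k ≡ suc (𝟙 (does left₁?) + rightCount k)
  classSize-k = trans (classSize-K₂ k)
    (cong (λ b → 𝟙 b + (𝟙 (does left₁?) + rightCount k)) (dec-true (k Fin.≟ k) refl))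
  floor≥3 : 3 ≤ (2 + n) / suc q₀
  floor≥3 = subst (_≤ (2 + n) / suc q₀) (m*n/n≡m 3 (suc q₀))
    (/-monoˡ-≤ (suc q₀) (subst (_≤ 2 + n) (*-comm (suc q₀) 3) q*3≤N))
  size≥3 : 3 ≤ suc (𝟙 (does left₁?) + rightCount k)
  size≥3 = subst (3 ≤_) classSize-k (≤-trans floor≥3 (sizeOK⇒floor≤ {q₀} {2 + n} (proj₁ (equitable k))))
  left₁∈k : c left₁ ≡ k
  left₁∈k = does≡true⇒ left₁? (𝟙≥1⇒true (+-cancelʳ-≤ 1 1 _
    (≤-trans (≤-pred size≥3) (+-monoʳ-≤ (𝟙 (does left₁?)) rightCount≤1))))
  rightCount≥1 : 1 ≤ rightCount k
  rightCount≥1 = +-cancelˡ-≤ 1 1 _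
    (≤-trans (≤-pred size≥3) (+-monoˡ-≤ (rightCount k) (𝟙≤1 (does left₁?))))
  right-witness : ∃ λ j → does (c (right j) Fin.≟ k) ≡ true
  right-witness = count>0⇒∃ (λ j → does (c (right j) Fin.≟ k)) rightCount≥1
  j : Fin n
  j = proj₁ right-witness
  right-j∈k : c (right j) ≡ k
  right-j∈k = does≡true⇒ (c (right j) Fin.≟ k) (proj₂ right-witness)
  two : 2 ≤ 𝟙 (does (c left₀ Fin.≟ c (right j))) + 𝟙 (does (c left₁ Fin.≟ c (right j)))
  two rewrite dec-true (c left₀ Fin.≟ c (right j)) (sym right-j∈k)
            | dec-true (c left₁ Fin.≟ c (right j)) (trans left₁∈k (sym right-j∈k)) = ≤-refl

module Construction (m₀ : ℕ) where

  m : ℕ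
  m = suc m₀

  top : Fin (suc m)
  top = Fin.fromℕ m

  colouring : ∀ {n} → Fin (suc m) → Fin (2 + n) → Fin (suc m)
  colouring β left₀     = top
  colouring β left₁     = β
  colouring β (right j) = Fin.inject₁ (toℕ j mod m)

  toℕ-colouring-right : ∀ {n} β (j : Fin n) → toℕ (colouring β (right j)) ≡ toℕ j % m
  toℕ-colouring-right β j = trans (toℕ-inject₁ (toℕ j mod m)) (toℕ-fromℕ< _)

  ≢top⇒toℕ<m : ∀ {k} → k ≢ top → toℕ k < m
  ≢top⇒toℕ<m {k} k≢top = ≤∧≢⇒< (≤-pred (toℕ<n k))
    λ k≡m → k≢top (toℕ-injective (trans k≡m (sym (toℕ-fromℕ m))))

  top≟below≡false : ∀ {k} → toℕ k < m → does (top Fin.≟ k) ≡ false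
  top≟below≡false {k} k<m = dec-false (top Fin.≟ k) λ top≡k →
    <-irrefl (trans (cong toℕ (sym top≡k)) (toℕ-fromℕ m)) k<m

  module Shape (t r : ℕ) (r≤m : r ≤ m) (β : Fin (suc m)) where

    n : ℕ
    n = t * m + r

    c : Fin (2 + n) → Fin (suc m)
    c = colouring β

    open K₂ c

    rightCount≡ : ∀ k → rightCount k ≡ t * count {m} (index≟ (toℕ k)) + count {r} (index≟ (toℕ k))
    rightCount≡ k = trans
      (count-cong {n} λ j → trans (does-≟-toℕ (c (right j)) k)
                                   (cong (λ z → does (z ℕ.≟ toℕ k)) (toℕ-colouring-right β j)))
      (count-residue m (toℕ k) t r≤m)

    classSize-top : classSize (K 2 n) c top ≡ suc (𝟙 (does (β Fin.≟ top)))
    classSize-top = begin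
      classSize (K 2 n) c top
        ≡⟨ classSize-K₂ top ⟩
      𝟙 (does (top Fin.≟ top)) + (𝟙 (does (β Fin.≟ top)) + rightCount top)
        ≡⟨ cong₂ (λ b x → 𝟙 b + (𝟙 (does (β Fin.≟ top)) + x))
                 (dec-true (top Fin.≟ top) refl) (rightCount≡ top) ⟩
      suc (𝟙 (does (β Fin.≟ top)) + (t * count {m} (index≟ (toℕ top)) + count {r} (index≟ (toℕ top))))
        ≡⟨ cong (λ x → suc (𝟙 (does (β Fin.≟ top)) + x)) nothing-at-top ⟩
      suc (𝟙 (does (β Fin.≟ top)) + 0)
        ≡⟨ cong suc (+-identityʳ _) ⟩
      suc (𝟙 (does (β Fin.≟ top)))
        ∎
      where
      open ≡-Reasoning
      nothing-at-top : t * count {m} (index≟ (toℕ top)) + count {r} (index≟ (toℕ top)) ≡ 0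
      nothing-at-top = begin
        t * count {m} (index≟ (toℕ top)) + count {r} (index≟ (toℕ top))
          ≡⟨ cong (λ κ → t * count {m} (index≟ κ) + count {r} (index≟ κ)) (toℕ-fromℕ m) ⟩
        t * count {m} (index≟ m) + count {r} (index≟ m)
          ≡⟨ cong₂ (λ x y → t * x + y) (count-index≟-≥ {m} ≤-refl) (count-index≟-≥ {r} r≤m) ⟩
        t * 0 + 0
          ≡⟨ trans (+-identityʳ (t * 0)) (*-zeroʳ t) ⟩
        0 ∎

    classSize-below-top : ∀ k → toℕ k < m →
                          classSize (K 2 n) c k ≡ 𝟙 (does (β Fin.≟ k)) + (t + count {r} (index≟ (toℕ k)))
    classSize-below-top k k<m = begin
      classSize (K 2 n) c k
        ≡⟨ classSize-K₂ k ⟩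
      𝟙 (does (top Fin.≟ k)) + (𝟙 (does (β Fin.≟ k)) + rightCount k)
        ≡⟨ cong₂ (λ b x → 𝟙 b + (𝟙 (does (β Fin.≟ k)) + x)) (top≟below≡false k<m) (rightCount≡ k) ⟩
      𝟙 (does (β Fin.≟ k)) + (t * count {m} (index≟ (toℕ k)) + count {r} (index≟ (toℕ k)))
        ≡⟨ cong (λ x → 𝟙 (does (β Fin.≟ k)) + (x + count {r} (index≟ (toℕ k))))
                (trans (cong (t *_) (count-index≟-< k<m)) (*-identityʳ t)) ⟩
      𝟙 (does (β Fin.≟ k)) + (t + count {r} (index≟ (toℕ k)))
        ∎
      where open ≡-Reasoning

    colourable : (∀ j → c (right j) ≢ β) →
                 (∀ k → SizeOK (suc m) (2 + n) (classSize (K 2 n) c k)) →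
                 EqTreeColorable (K 2 n) (suc m) 1
    colourable right≢β sizes = tree-colouring (K 2 n) c sizes λ v →
      ≤-trans (≤-reflexive (classDeg≡0 (λ j → fromℕ≢inject₁ ∘ sym) right≢β v)) z≤n

    classSize-cases : (P : ℕ → Set) → P (suc (𝟙 (does (β Fin.≟ top)))) →
      (∀ k → toℕ k < m → toℕ k < r → P (𝟙 (does (β Fin.≟ k)) + (t + 1))) →
      (∀ k → toℕ k < m → r ≤ toℕ k → P (𝟙 (does (β Fin.≟ k)) + (t + 0))) →
      ∀ k → P (classSize (K 2 n) c k)
    classSize-cases P at-top hit miss k with k Fin.≟ top
    ... | yes refl  = subst P (sym classSize-top) at-top
    ... | no  k≢top = below (≢top⇒toℕ<m k≢top)
      where
      size≡ : ∀ {x} → toℕ k < m → count {r} (index≟ (toℕ k)) ≡ x →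
              classSize (K 2 n) c k ≡ 𝟙 (does (β Fin.≟ k)) + (t + x)
      size≡ k<m eq = trans (classSize-below-top k k<m) (cong (λ x → 𝟙 (does (β Fin.≟ k)) + (t + x)) eq)
      below : toℕ k < m → P (classSize (K 2 n) c k)
      below k<m with toℕ k <? r
      ... | yes k<r = subst P (sym (size≡ k<m (count-index≟-< k<r))) (hit k k<m k<r)
      ... | no  k≮r = subst P (sym (size≡ k<m (count-index≟-≥ (≮⇒≥ k≮r)))) (miss k k<m (≮⇒≥ k≮r))

  shared-top-sizes : ∀ t r (r≤m : r ≤ m) (P : ℕ → Set) →
                     P 2 → (0 < r → P (t + 1)) → (r < m → P (t + 0)) →
                     ∀ k → P (classSize (K 2 (t * m + r)) (colouring top) k)
  shared-top-sizes t r r≤m P two hit miss = classSize-cases P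
    (subst (λ b → P (suc (𝟙 b))) (sym (dec-true (top Fin.≟ top) refl)) two)
    (λ k k<m k<r → subst (λ b → P (𝟙 b + (t + 1))) (sym (top≟below≡false k<m)) (hit (≤-<-trans z≤n k<r)))
    (λ k k<m r≤k → subst (λ b → P (𝟙 b + (t + 0))) (sym (top≟below≡false k<m)) (miss (≤-<-trans r≤k k<m)))
    where open Shape t r r≤m top

  β₀ : Fin (suc m)
  β₀ = Fin.inject₁ (Fin.fromℕ m₀)

  toℕ-β₀ : toℕ β₀ ≡ m₀
  toℕ-β₀ = trans (toℕ-inject₁ (Fin.fromℕ m₀)) (toℕ-fromℕ m₀)

  β₀≟below≡false : ∀ {k} → toℕ k < m₀ → does (β₀ Fin.≟ k) ≡ false
  β₀≟below≡false {k} k<m₀ = dec-false (β₀ Fin.≟ k) λ β₀≡k →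
    <-irrefl (trans (cong toℕ (sym β₀≡k)) toℕ-β₀) k<m₀

  apart-sizes : ∀ r (r≤m₀ : r ≤ m₀) (P : ℕ → Set) → P 1 → (r < m₀ → P 0) →
                ∀ k → P (classSize (K 2 r) (colouring β₀) k)
  apart-sizes r r≤m₀ P one none = classSize-cases P
    (subst (λ b → P (suc (𝟙 b))) (sym (dec-false (β₀ Fin.≟ top) (fromℕ≢inject₁ ∘ sym))) one)
    (λ k _ k<r → subst (λ b → P (𝟙 b + 1)) (sym (β₀≟below≡false (<-≤-trans k<r r≤m₀))) one)
    miss
    where
    open Shape 0 r (≤-trans r≤m₀ (n≤1+n m₀)) β₀
    miss : ∀ k → toℕ k < m → r ≤ toℕ k → P (𝟙 (does (β₀ Fin.≟ k)) + 0)
    miss k k<m r≤k with β₀ Fin.≟ k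
    ... | yes _   = one
    ... | no β₀≢k = none (≤-<-trans r≤k (≤∧≢⇒< (≤-pred k<m) λ k≡m₀ →
                    β₀≢k (toℕ-injective (trans toℕ-β₀ (sym k≡m₀)))))

  colourable-n<m : ∀ r → r ≤ m₀ → EqTreeColorable (K 2 r) (suc m) 1
  colourable-n<m r r≤m₀ = colourable right≢β₀ (apart-sizes r r≤m₀ (SizeOK (suc m) (2 + r)) one none)
    where
    open Shape 0 r (≤-trans r≤m₀ (n≤1+n m₀)) β₀
    right≢β₀ : ∀ j → c (right j) ≢ β₀
    right≢β₀ j c≡β₀ = <-irrefl j≡m₀ (<-≤-trans (toℕ<n j) r≤m₀)
      where
      j≡m₀ : toℕ j ≡ m₀
      j≡m₀ = begin
        toℕ j                  ≡⟨ m<n⇒m%n≡m (<-≤-trans (toℕ<n j) (≤-trans r≤m₀ (n≤1+n m₀))) ⟨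
        toℕ j % m              ≡⟨ toℕ-colouring-right β₀ j ⟨
        toℕ (c (right j))      ≡⟨ cong toℕ c≡β₀ ⟩
        toℕ β₀                 ≡⟨ toℕ-β₀ ⟩
        m₀                     ∎
        where open ≡-Reasoning
    one : SizeOK (suc m) (2 + r) 1
    one = sizeOK-ceil 0 (s≤s z≤n) (s≤s (s≤s r≤m₀))
    none : r < m₀ → SizeOK (suc m) (2 + r) 0
    none r<m₀ = sizeOK-floor 0 (s≤s (s≤s r<m₀))

  colourable-m+r : ∀ r → r ≤ m → EqTreeColorable (K 2 (1 * m + r)) (suc m) 1
  colourable-m+r r r≤m = colourable (λ j → fromℕ≢inject₁ ∘ sym)
    (shared-top-sizes 1 r r≤m (SizeOK (suc m) (2 + n)) two (λ _ → two) one)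
    where
    open Shape 1 r r≤m top
    N≡ : ∀ a b → 2 + (1 * a + b) ≡ 1 * suc a + suc b
    N≡ = solve-∀
    two : SizeOK (suc m) (2 + n) 2
    two = subst (λ N → SizeOK (suc m) N 2) (sym (N≡ m r)) (sizeOK-ceil 1 (s≤s z≤n) (s≤s r≤m))
    one : r < m → SizeOK (suc m) (2 + n) 1
    one r<m = subst (λ N → SizeOK (suc m) N 1) (sym (N≡ m r)) (sizeOK-floor 1 (s≤s r<m))

  colourable-2m+r : ∀ r → r ≤ m → EqTreeColorable (K 2 (2 * m + r)) (suc m) 1
  colourable-2m+r r r≤m = colourable (λ j → fromℕ≢inject₁ ∘ sym)
    (shared-top-sizes 2 r r≤m (SizeOK (suc m) (2 + n)) two three (λ _ → two))
    where
    open Shape 2 r r≤m top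
    N≡ : ∀ a b → 2 + (2 * a + b) ≡ 2 * suc a + b
    N≡ = solve-∀
    two : SizeOK (suc m) (2 + n) 2
    two = subst (λ N → SizeOK (suc m) N 2) (sym (N≡ m r)) (sizeOK-floor 2 (s≤s r≤m))
    three : 0 < r → SizeOK (suc m) (2 + n) 3
    three 0<r = subst (λ N → SizeOK (suc m) N 3) (sym (N≡ m r)) (sizeOK-ceil 2 0<r (≤-trans r≤m (n≤1+n m)))

band-decomposition : ∀ t m {n} → t * m ≤ n → n ≤ suc t * m → ∃ λ r → r ≤ m × t * m + r ≡ n
band-decomposition t m {n} lower upper = n ∸ t * m , r≤m , m+[n∸m]≡n lower
  where
  r≤m : n ∸ t * m ≤ m
  r≤m = subst (n ∸ t * m ≤_) (m+n∸n≡m m (t * m)) (∸-monoˡ-≤ (t * m) upper)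

equitable-tree-colouring : ∀ {n q} → 1 ≤ n → n + 3 ≤ q * 3 → EqTreeColorable (K 2 n) q 1
equitable-tree-colouring {n} {zero} _ n+3≤0 with ≤-trans (m≤n+m 3 n) n+3≤0
... | ()
equitable-tree-colouring {n} {suc zero} 1≤n n+3≤3 with ≤-trans (+-monoˡ-≤ 3 1≤n) n+3≤3
... | s≤s (s≤s (s≤s ()))
equitable-tree-colouring {n} {suc (suc m₀)} _ n+3≤q*3 with n ≤? m₀
... | yes n≤m₀ = colourable-n<m n n≤m₀
  where open Construction m₀
... | no n≰m₀ with n ≤? 2 * suc m₀
...   | yes n≤2m = shape (band-decomposition 1 m (subst (_≤ n) (sym (*-identityˡ m)) (≰⇒> n≰m₀)) n≤2m)
  where
  open Construction m₀
  shape : ∃ (λ r → r ≤ m × 1 * m + r ≡ n) → EqTreeColorable (K 2 n) (suc m) 1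
  shape (r , r≤m , refl) = colourable-m+r r r≤m
...   | no n≰2m = shape (band-decomposition 2 m (<⇒≤ (≰⇒> n≰2m)) n≤3m)
  where
  open Construction m₀
  n≤3m : n ≤ 3 * m
  n≤3m = subst (n ≤_) (*-comm m 3) (+-cancelʳ-≤ 3 n (m * 3) (subst (n + 3 ≤_) (+-comm 3 (m * 3)) n+3≤q*3))
  shape : ∃ (λ r → r ≤ m × 2 * m + r ≡ n) → EqTreeColorable (K 2 n) (suc m) 1
  shape (r , r≤m , refl) = colourable-2m+r r r≤m

⌈/suc⌉≤⇔ : ∀ a b q → ⌈ a /suc b ⌉ ≤ q ⇔ a ≤ q * suc b
⌈/suc⌉≤⇔ a b q = mk⇔ to from
  where
  open ≤-Reasoning
  to : (a + b) / suc b ≤ q → a ≤ q * suc b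
  to ⌈⌉≤q = +-cancelʳ-≤ b a (q * suc b) (≤-pred (begin-strict
    a + b                                   ≡⟨ m≡m%n+[m/n]*n (a + b) (suc b) ⟩
    (a + b) % suc b + (a + b) / suc b * suc b <⟨ +-monoˡ-< _ (m%n<n (a + b) (suc b)) ⟩
    suc b + (a + b) / suc b * suc b          ≤⟨ +-monoʳ-≤ (suc b) (*-monoˡ-≤ (suc b) ⌈⌉≤q) ⟩
    suc b + q * suc b                       ≡⟨ +-comm (suc b) _ ⟩
    q * suc b + suc b                       ≡⟨ +-suc (q * suc b) b ⟩
    suc (q * suc b + b)                     ∎))
  from : a ≤ q * suc b → (a + b) / suc b ≤ q
  from a≤ = ≤-pred (m<n*o⇒m/o<n (begin-strict
    a + b              ≤⟨ +-monoˡ-≤ b a≤ ⟩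
    q * suc b + b      <⟨ +-monoʳ-< (q * suc b) (n<1+n b) ⟩
    q * suc b + suc b  ≡⟨ +-comm _ (suc b) ⟩
    suc q * suc b      ∎))

lemma6 : ∀ (n : ℕ) → 1 ≤ n → IsStrongEqVA (K 2 n) 1 ⌈ n + 3 /suc 2 ⌉
lemma6 n 1≤n = all-from , least
  where
  all-from : AllFrom (K 2 n) 1 ⌈ n + 3 /suc 2 ⌉
  all-from q p≤q = equitable-tree-colouring 1≤n (Equivalence.to (⌈/suc⌉≤⇔ (n + 3) 2 q) p≤q)
  least : ∀ p′ → AllFrom (K 2 n) 1 p′ → ⌈ n + 3 /suc 2 ⌉ ≤ p′
  least p′ colourable with n + 3 ≤? p′ * 3
  ... | yes n+3≤p′*3 = Equivalence.from (⌈/suc⌉≤⇔ (n + 3) 2 p′) n+3≤p′*3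
  ... | no  n+3≰p′*3 = contradiction (colourable p′ ≤-refl) (no-equitable-tree-colouring p′*3≤2+n)
    where
    p′*3≤2+n : p′ * 3 ≤ 2 + n
    p′*3≤2+n = ≤-pred (subst (p′ * 3 <_) (+-comm n 3) (≰⇒> n+3≰p′*3))
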